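{- Let $n\geqslant 10$ be even and let $\lambda$ be an integer with $\frac{n + 2}{4} \leqslant \lambda \leqslant \frac{n - 4}{2}$. Then $\mathbf{i}=\left(\lambda + 1, \frac{n + 2 - 2\lambda}{2}, 3, 2\times \left(\frac{n-4}{2} - \lambda\right), 1\times \frac{4\lambda - n - 2}{2}\right)$ is a partition of $n$ and $\Lambda(\mathbf{i})=\lambda$; in particular $\lambda$ is an eigenvalue of $T_n$.
   Context: Notation $k\times t$ inside a partition means the part $k$ repeated $t$ times. For an integer partition $\mathbf{i}=(n_1,\dots,n_k)$ of $n$ (nonincreasing positive integers summing to $n$), $\Lambda(\mathbf{i})=\sum_{j=1}^k \frac{n_j(n_j-2j+1)}{2}$; this is the eigenvalue of the Transposition graph $T_n=\mathrm{Cay}(\mathrm{Sym}_n,\{\text{all transpositions}\})$ associated with the irreducible character of $\mathrm{Sym}_n$ indexed by $\mathbf{i}$, so $\Lambda(\mathbf{i})$ is an eigenvalue of $T_n$. -}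

module Defs where

open import Data.Nat using (ℕ; zero; suc; _≤_; _≥_; _<_)
import Data.Nat as ℕ
open import Data.Integer using (ℤ; +_; _-_; _*_; _+_)
open import Data.Integer.DivMod using (_/ℕ_)
open import Data.List using (List; []; _∷_)
open import Data.Nat.ListAction using (sum)
open import Data.List.Relation.Unary.All using (All)
open import Relation.Binary.PropositionalEquality using (_≡_)
open import Data.Product using (_×_)
open import Data.Unit using (⊤)

NonIncreasing : List ℕ → Set
NonIncreasing []           = ⊤
NonIncreasing (x ∷ [])     = ⊤
NonIncreasing (x ∷ y ∷ xs) = (y ≤ x) × NonIncreasing (y ∷ xs)

IsPartition : ℕ → List ℕ → Set
IsPartition n i = NonIncreasing i × All (λ m → 0 < m) i × sum i ≡ n

-- Λ-term for part m in position j (1-based): m (m - 2j + 1) / 2, computed in ℤ.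
-- (m (m - 2j + 1) is always even, so the division is exact.)
Λterm : ℕ → ℕ → ℤ
Λterm j m = ((+ m) * ((+ m) - + (2 ℕ.* j) + + 1)) /ℕ 2

Λfrom : ℕ → List ℕ → ℤ
Λfrom j []       = + 0
Λfrom j (m ∷ ms) = Λterm j m + Λfrom (suc j) ms

Λ : List ℕ → ℤ
Λ i = Λfrom 1 i

{-# OPTIONS --safe #-}

-- Write n = 2q. The hypotheses say precisely that t = q − λ − 2 and s = 2λ − q − 1 are
-- natural numbers; then λ = 3 + s + t, q = 5 + s + 2t, and the partition is
-- (λ + 1, 3 + t, 3, 2 × t, 1 × s), whose parts visibly sum to 2q.
-- Each numerator m (m − 2j + 1) equals 2 (C(m+1,2) − j m), so the division in Λ is exact
-- and it suffices to compute 2Λ. A run of t parts equal to m starting in position j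
-- contributes t m (m − 2j − t + 2) to 2Λ, and adding up the five contributions is a
-- polynomial identity in s and t that yields 2λ.
module Submission where

open import Defs
open import Data.Nat using (ℕ; zero; suc; NonZero; z≤n; s≤s; _≤_; _+_; _*_; _∸_; _/_)
open import Data.Nat.Properties
  using (≤-refl; ≤-reflexive; ≤-trans; +-monoˡ-≤; m≤m+n; m+n∸n≡m; m∸n+n≡m; ∸-+-assoc;
         +-cancelˡ-≡; +-identityʳ; +-suc; *-distribʳ-+; *-cancelʳ-≤; m≤n⇒∃[o]m+o≡n; module ≤-Reasoning)
open import Data.Nat.DivMod using (_%_; m*n/n≡m; m*n%n≡0)
open import Data.Nat.Divisibility using (_∣_; divides)
open import Data.Nat.Combinatorics using (_C_; nC1≡n; nCk+nC[k+1]≡[n+1]C[k+1])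
open import Data.Nat.Tactic.RingSolver as ℕ-Solver using ()
open import Data.Integer as ℤ using (ℤ; +_; -[1+_]; _/ℕ_)
open import Data.Integer.Properties as ℤ using (pos-*)
open import Data.Integer.Tactic.RingSolver as ℤ-Solver using ()
open import Data.List using (List; []; _∷_; _++_; replicate; length)
open import Data.List.Properties using (length-replicate)
open import Data.List.Relation.Unary.All using (_∷_)
open import Data.List.Relation.Unary.All.Properties using (++⁺; replicate⁺)
open import Data.Nat.ListAction using (sum)
open import Data.Nat.ListAction.Properties using (sum-++)
open import Data.Product using (_×_; _,_; ∃₂)
open import Data.Unit using (tt)
open import Relation.Binary.PropositionalEquality
  using (_≡_; refl; sym; trans; cong; cong₂; subst; module ≡-Reasoning)

i*n/ℕn≡i : ∀ i n .{{_ : NonZero n}} → (i ℤ.* + n) /ℕ n ≡ i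
i*n/ℕn≡i (+ k)    n         = trans (cong (_/ℕ n) (sym (pos-* k n))) (cong +_ (m*n/n≡m k n))
i*n/ℕn≡i -[1+ k ] n@(suc _) with suc k * n % n | m*n%n≡0 (suc k) n
... | .0 | refl = cong (λ x → ℤ.- + x) (m*n/n≡m (suc k) n)

[1+n]C2*2≡n*[1+n] : ∀ n → (suc n C 2) * 2 ≡ n * suc n
[1+n]C2*2≡n*[1+n] zero    = refl
[1+n]C2*2≡n*[1+n] (suc n) = begin
  (suc (suc n) C 2) * 2            ≡⟨ cong (_* 2) (sym (nCk+nC[k+1]≡[n+1]C[k+1] (suc n) 1)) ⟩
  ((suc n C 1) + (suc n C 2)) * 2  ≡⟨ cong (λ x → (x + (suc n C 2)) * 2) (nC1≡n (suc n)) ⟩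
  (suc n + (suc n C 2)) * 2        ≡⟨ *-distribʳ-+ 2 (suc n) (suc n C 2) ⟩
  suc n * 2 + (suc n C 2) * 2      ≡⟨ cong (λ x → suc n * 2 + x) ([1+n]C2*2≡n*[1+n] n) ⟩
  suc n * 2 + n * suc n            ≡⟨ regroup n ⟩
  suc n * suc (suc n)              ∎
  where
  open ≡-Reasoning
  regroup : ∀ n → suc n * 2 + n * suc n ≡ suc n * suc (suc n)
  regroup = ℕ-Solver.solve-∀

Λterm-numerator≡ : ∀ j m → + m ℤ.* (+ m ℤ.- + (2 * j) ℤ.+ + 1) ≡ (+ (suc m C 2) ℤ.- + j ℤ.* + m) ℤ.* + 2
Λterm-numerator≡ j m = begin
  + m ℤ.* (+ m ℤ.- + (2 * j) ℤ.+ + 1)            ≡⟨ cong (λ x → + m ℤ.* (+ m ℤ.- x ℤ.+ + 1)) (pos-* 2 j) ⟩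
  + m ℤ.* (+ m ℤ.- + 2 ℤ.* + j ℤ.+ + 1)          ≡⟨ expand (+ m) (+ j) ⟩
  + m ℤ.* + suc m ℤ.- + j ℤ.* + m ℤ.* + 2        ≡⟨ cong (ℤ._- + j ℤ.* + m ℤ.* + 2) triangle ⟩
  + (suc m C 2) ℤ.* + 2 ℤ.- + j ℤ.* + m ℤ.* + 2  ≡⟨ factor (+ (suc m C 2)) (+ j ℤ.* + m) ⟩
  (+ (suc m C 2) ℤ.- + j ℤ.* + m) ℤ.* + 2        ∎
  where
  open ≡-Reasoning
  expand : ∀ M J → M ℤ.* (M ℤ.- + 2 ℤ.* J ℤ.+ + 1) ≡ M ℤ.* (+ 1 ℤ.+ M) ℤ.- J ℤ.* M ℤ.* + 2
  expand = ℤ-Solver.solve-∀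
  factor : ∀ A B → A ℤ.* + 2 ℤ.- B ℤ.* + 2 ≡ (A ℤ.- B) ℤ.* + 2
  factor = ℤ-Solver.solve-∀
  triangle : + m ℤ.* + suc m ≡ + (suc m C 2) ℤ.* + 2
  triangle = trans (sym (pos-* m (suc m))) (trans (cong +_ (sym ([1+n]C2*2≡n*[1+n] m))) (pos-* (suc m C 2) 2))

Λterm-double : ∀ j m → Λterm j m ℤ.* + 2 ≡ + m ℤ.* (+ m ℤ.- + 2 ℤ.* + j ℤ.+ + 1)
Λterm-double j m = begin
  Λterm j m ℤ.* + 2                         ≡⟨ cong (λ x → (x /ℕ 2) ℤ.* + 2) (Λterm-numerator≡ j m) ⟩
  (half ℤ.* + 2) /ℕ 2 ℤ.* + 2               ≡⟨ cong (ℤ._* + 2) (i*n/ℕn≡i half 2) ⟩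
  half ℤ.* + 2                              ≡⟨ sym (Λterm-numerator≡ j m) ⟩
  + m ℤ.* (+ m ℤ.- + (2 * j) ℤ.+ + 1)       ≡⟨ cong (λ x → + m ℤ.* (+ m ℤ.- x ℤ.+ + 1)) (pos-* 2 j) ⟩
  + m ℤ.* (+ m ℤ.- + 2 ℤ.* + j ℤ.+ + 1)     ∎
  where
  open ≡-Reasoning
  half : ℤ
  half = + (suc m C 2) ℤ.- + j ℤ.* + m

Λfrom-++ : ∀ j xs ys → Λfrom j (xs ++ ys) ≡ Λfrom j xs ℤ.+ Λfrom (j + length xs) ys
Λfrom-++ j [] ys = begin
  Λfrom j ys              ≡⟨ cong (λ k → Λfrom k ys) (sym (+-identityʳ j)) ⟩
  Λfrom (j + 0) ys        ≡⟨ sym (ℤ.+-identityˡ _) ⟩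
  + 0 ℤ.+ Λfrom (j + 0) ys ∎
  where open ≡-Reasoning
Λfrom-++ j (x ∷ xs) ys = begin
  Λterm j x ℤ.+ Λfrom (suc j) (xs ++ ys)
    ≡⟨ cong (λ r → Λterm j x ℤ.+ r) (Λfrom-++ (suc j) xs ys) ⟩
  Λterm j x ℤ.+ (Λfrom (suc j) xs ℤ.+ Λfrom (suc j + length xs) ys)
    ≡⟨ sym (ℤ.+-assoc (Λterm j x) _ _) ⟩
  Λterm j x ℤ.+ Λfrom (suc j) xs ℤ.+ Λfrom (suc j + length xs) ys
    ≡⟨ cong (λ k → Λfrom j (x ∷ xs) ℤ.+ Λfrom k ys) (sym (+-suc j (length xs))) ⟩
  Λfrom j (x ∷ xs) ℤ.+ Λfrom (j + length (x ∷ xs)) ys ∎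
  where open ≡-Reasoning

Λfrom-replicate-double : ∀ j t m →
  Λfrom j (replicate t m) ℤ.* + 2 ≡ + t ℤ.* + m ℤ.* (+ m ℤ.- + 2 ℤ.* + j ℤ.- + t ℤ.+ + 2)
Λfrom-replicate-double j zero m = refl
Λfrom-replicate-double j (suc t) m = begin
  (Λterm j m ℤ.+ Λfrom (suc j) (replicate t m)) ℤ.* + 2
    ≡⟨ ℤ.*-distribʳ-+ (+ 2) (Λterm j m) _ ⟩
  Λterm j m ℤ.* + 2 ℤ.+ Λfrom (suc j) (replicate t m) ℤ.* + 2
    ≡⟨ cong₂ ℤ._+_ (Λterm-double j m) (Λfrom-replicate-double (suc j) t m) ⟩
  + m ℤ.* (+ m ℤ.- + 2 ℤ.* + j ℤ.+ + 1)
    ℤ.+ + t ℤ.* + m ℤ.* (+ m ℤ.- + 2 ℤ.* (+ 1 ℤ.+ + j) ℤ.- + t ℤ.+ + 2)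
    ≡⟨ step (+ j) (+ t) (+ m) ⟩
  (+ 1 ℤ.+ + t) ℤ.* + m ℤ.* (+ m ℤ.- + 2 ℤ.* + j ℤ.- (+ 1 ℤ.+ + t) ℤ.+ + 2) ∎
  where
  open ≡-Reasoning
  step : ∀ J T M → M ℤ.* (M ℤ.- + 2 ℤ.* J ℤ.+ + 1) ℤ.+ T ℤ.* M ℤ.* (M ℤ.- + 2 ℤ.* (+ 1 ℤ.+ J) ℤ.- T ℤ.+ + 2)
                   ≡ (+ 1 ℤ.+ T) ℤ.* M ℤ.* (M ℤ.- + 2 ℤ.* J ℤ.- (+ 1 ℤ.+ T) ℤ.+ + 2)
  step = ℤ-Solver.solve-∀

nonIncreasing-replicate : ∀ {x m k} t s → k ≤ m → m ≤ x → NonIncreasing (x ∷ replicate t m ++ replicate s k)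
nonIncreasing-replicate zero    zero    k≤m m≤x = tt
nonIncreasing-replicate zero    (suc s) k≤m m≤x = ≤-trans k≤m m≤x , nonIncreasing-replicate zero s ≤-refl ≤-refl
nonIncreasing-replicate (suc t) s       k≤m m≤x = m≤x , nonIncreasing-replicate t s k≤m ≤-refl

sum-replicate : ∀ t m → sum (replicate t m) ≡ t * m
sum-replicate zero    m = refl
sum-replicate (suc t) m = cong (λ r → m + r) (sum-replicate t m)

m≡o*2+n⇒[m∸n]/2≡o : ∀ m n o → m ≡ o * 2 + n → (m ∸ n) / 2 ≡ o
m≡o*2+n⇒[m∸n]/2≡o _ n o refl = trans (cong (_/ 2) (m+n∸n≡m (o * 2) n)) (m*n/n≡m o 2)

2*m≤n*2∸4⇒m+2≤n : ∀ {m n} → 4 ≤ n * 2 → 2 * m ≤ n * 2 ∸ 4 → m + 2 ≤ n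
2*m≤n*2∸4⇒m+2≤n {m} {n} 4≤2n 2m≤2n∸4 = *-cancelʳ-≤ (m + 2) n 2 (begin
  (m + 2) * 2      ≡⟨ shift m ⟩
  2 * m + 4        ≤⟨ +-monoˡ-≤ 4 2m≤2n∸4 ⟩
  n * 2 ∸ 4 + 4    ≡⟨ m∸n+n≡m 4≤2n ⟩
  n * 2            ∎)
  where
  open ≤-Reasoning
  shift : ∀ m → (m + 2) * 2 ≡ 2 * m + 4
  shift = ℕ-Solver.solve-∀

n*2+2≤4*m⇒n+1≤2*m : ∀ {m n} → n * 2 + 2 ≤ 4 * m → n + 1 ≤ 2 * m
n*2+2≤4*m⇒n+1≤2*m {m} {n} 2n+2≤4m = *-cancelʳ-≤ (n + 1) (2 * m) 2 (begin
  (n + 1) * 2      ≡⟨ *-distribʳ-+ 2 n 1 ⟩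
  n * 2 + 2        ≤⟨ 2n+2≤4m ⟩
  4 * m            ≡⟨ quadruple m ⟩
  2 * m * 2        ∎)
  where
  open ≤-Reasoning
  quadruple : ∀ m → 4 * m ≡ 2 * m * 2
  quadruple = ℕ-Solver.solve-∀

eigenvalue : ℕ → ℕ → ℕ
eigenvalue s t = 3 + s + t

shape : ℕ → ℕ → List ℕ
shape s t = (eigenvalue s t + 1) ∷ (3 + t) ∷ 3 ∷ (replicate t 2 ++ replicate s 1)

Λ-shape : ∀ s t → Λ (shape s t) ≡ + eigenvalue s t
Λ-shape s t = ℤ.*-cancelʳ-≡ _ _ (+ 2) (begin
  Λ (shape s t) ℤ.* + 2
    ≡⟨ cong (λ r → (Λterm 1 (eigenvalue s t + 1) ℤ.+ (Λterm 2 (3 + t) ℤ.+ (Λterm 3 3 ℤ.+ r))) ℤ.* + 2) split ⟩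
  (Λterm 1 (eigenvalue s t + 1) ℤ.+ (Λterm 2 (3 + t) ℤ.+ (Λterm 3 3 ℤ.+ (Λfrom 4 twos ℤ.+ Λfrom (4 + t) ones)))) ℤ.* + 2
    ≡⟨ distrib (Λterm 1 (eigenvalue s t + 1)) (Λterm 2 (3 + t)) (Λterm 3 3) (Λfrom 4 twos) (Λfrom (4 + t) ones) ⟩
  Λterm 1 (eigenvalue s t + 1) ℤ.* + 2 ℤ.+ Λterm 2 (3 + t) ℤ.* + 2 ℤ.+ Λterm 3 3 ℤ.* + 2
    ℤ.+ Λfrom 4 twos ℤ.* + 2 ℤ.+ Λfrom (4 + t) ones ℤ.* + 2
    ≡⟨ cong₂ ℤ._+_ (cong₂ ℤ._+_ (cong₂ ℤ._+_ (cong₂ ℤ._+_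
         (Λterm-double 1 (eigenvalue s t + 1)) (Λterm-double 2 (3 + t))) (Λterm-double 3 3))
         (Λfrom-replicate-double 4 t 2)) (Λfrom-replicate-double (4 + t) s 1) ⟩
  _ ≡⟨ polynomial (+ s) (+ t) ⟩
  + eigenvalue s t ℤ.* + 2 ∎)
  where
  open ≡-Reasoning
  twos ones : List ℕ
  twos = replicate t 2
  ones = replicate s 1
  split : Λfrom 4 (twos ++ ones) ≡ Λfrom 4 twos ℤ.+ Λfrom (4 + t) ones
  split = trans (Λfrom-++ 4 twos ones) (cong (λ k → Λfrom 4 twos ℤ.+ Λfrom (4 + k) ones) (length-replicate t))
  distrib : ∀ A B C D E → (A ℤ.+ (B ℤ.+ (C ℤ.+ (D ℤ.+ E)))) ℤ.* + 2
            ≡ A ℤ.* + 2 ℤ.+ B ℤ.* + 2 ℤ.+ C ℤ.* + 2 ℤ.+ D ℤ.* + 2 ℤ.+ E ℤ.* + 2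
  distrib = ℤ-Solver.solve-∀
  polynomial : ∀ S T → let L = + 3 ℤ.+ S ℤ.+ T in
    (L ℤ.+ + 1) ℤ.* ((L ℤ.+ + 1) ℤ.- + 2 ℤ.* + 1 ℤ.+ + 1)
    ℤ.+ (+ 3 ℤ.+ T) ℤ.* ((+ 3 ℤ.+ T) ℤ.- + 2 ℤ.* + 2 ℤ.+ + 1)
    ℤ.+ + 3 ℤ.* (+ 3 ℤ.- + 2 ℤ.* + 3 ℤ.+ + 1)
    ℤ.+ T ℤ.* + 2 ℤ.* (+ 2 ℤ.- + 2 ℤ.* + 4 ℤ.- T ℤ.+ + 2)
    ℤ.+ S ℤ.* + 1 ℤ.* (+ 1 ℤ.- + 2 ℤ.* (+ 4 ℤ.+ T) ℤ.- S ℤ.+ + 2)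
    ≡ L ℤ.* + 2
  polynomial = ℤ-Solver.solve-∀

shape-isPartition : ∀ s t → IsPartition ((5 + s + t * 2) * 2) (shape s t)
shape-isPartition s t = (3+t≤λ+1 , m≤m+n 3 t , nonIncreasing-replicate t s (s≤s z≤n) (s≤s (s≤s z≤n)))
                      , s≤s z≤n ∷ s≤s z≤n ∷ s≤s z≤n ∷ ++⁺ (replicate⁺ t (s≤s z≤n)) (replicate⁺ s (s≤s z≤n))
                      , total
  where
  open ≡-Reasoning
  3+t≤λ+1 : 3 + t ≤ eigenvalue s t + 1
  3+t≤λ+1 = ≤-trans (m≤m+n (3 + t) (s + 1)) (≤-reflexive (reorder s t))
    where
    reorder : ∀ s t → 3 + t + (s + 1) ≡ 3 + s + t + 1
    reorder = ℕ-Solver.solve-∀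
  total : sum (shape s t) ≡ (5 + s + t * 2) * 2
  total = begin
    eigenvalue s t + 1 + (3 + t + (3 + sum (replicate t 2 ++ replicate s 1)))
      ≡⟨ cong (λ r → eigenvalue s t + 1 + (3 + t + (3 + r))) (sum-++ (replicate t 2) (replicate s 1)) ⟩
    eigenvalue s t + 1 + (3 + t + (3 + (sum (replicate t 2) + sum (replicate s 1))))
      ≡⟨ cong₂ (λ a b → eigenvalue s t + 1 + (3 + t + (3 + (a + b)))) (sum-replicate t 2) (sum-replicate s 1) ⟩
    3 + s + t + 1 + (3 + t + (3 + (t * 2 + s * 1)))
      ≡⟨ collect s t ⟩
    (5 + s + t * 2) * 2 ∎
    where
    collect : ∀ s t → 3 + s + t + 1 + (3 + t + (3 + (t * 2 + s * 1))) ≡ (5 + s + t * 2) * 2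
    collect = ℕ-Solver.solve-∀

parts≡shape : ∀ s t → let n = (5 + s + t * 2) * 2; λ' = eigenvalue s t in
  (λ' + 1) ∷ ((n + 2 ∸ 2 * λ') / 2) ∷ 3 ∷ (replicate ((n ∸ 4) / 2 ∸ λ') 2 ++ replicate ((4 * λ' ∸ n ∸ 2) / 2) 1)
  ≡ shape s t
parts≡shape s t = cong₂ (λ b ts → (eigenvalue s t + 1) ∷ b ∷ 3 ∷ ts)
                    (m≡o*2+n⇒[m∸n]/2≡o _ _ (3 + t) (second s t))
                    (cong₂ (λ c d → replicate c 2 ++ replicate d 1) twos ones)
  where
  second : ∀ s t → (5 + s + t * 2) * 2 + 2 ≡ (3 + t) * 2 + 2 * (3 + s + t)
  second = ℕ-Solver.solve-∀
  half : ∀ s t → (5 + s + t * 2) * 2 ≡ (t + (3 + s + t)) * 2 + 4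
  half = ℕ-Solver.solve-∀
  excess : ∀ s t → 4 * (3 + s + t) ≡ s * 2 + ((5 + s + t * 2) * 2 + 2)
  excess = ℕ-Solver.solve-∀
  twos : ((5 + s + t * 2) * 2 ∸ 4) / 2 ∸ eigenvalue s t ≡ t
  twos = trans (cong (_∸ eigenvalue s t) (m≡o*2+n⇒[m∸n]/2≡o _ 4 (t + eigenvalue s t) (half s t)))
               (m+n∸n≡m t (eigenvalue s t))
  ones : (4 * eigenvalue s t ∸ (5 + s + t * 2) * 2 ∸ 2) / 2 ≡ s
  ones = trans (cong (_/ 2) (∸-+-assoc (4 * eigenvalue s t) ((5 + s + t * 2) * 2) 2))
               (m≡o*2+n⇒[m∸n]/2≡o _ _ s (excess s t))

parametrise : ∀ {q λ'} → λ' + 2 ≤ q → q + 1 ≤ 2 * λ' →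
  ∃₂ λ s t → q ≡ 5 + s + t * 2 × λ' ≡ eigenvalue s t
parametrise {λ' = λ'} λ'+2≤q q+1≤2λ' with m≤n⇒∃[o]m+o≡n λ'+2≤q | m≤n⇒∃[o]m+o≡n q+1≤2λ'
... | t , refl | s , q+1+s≡2λ' = s , t , trans (cong (λ l → l + 2 + t) λ'≡) (collect s t) , λ'≡
  where
  open ≡-Reasoning
  double : ∀ l → l + l ≡ 2 * l
  double = ℕ-Solver.solve-∀
  regroup : ∀ l s t → l + 2 + t + 1 + s ≡ l + (3 + s + t)
  regroup = ℕ-Solver.solve-∀
  collect : ∀ s t → 3 + s + t + 2 + t ≡ 5 + s + t * 2
  collect = ℕ-Solver.solve-∀
  λ'≡ : λ' ≡ eigenvalue s t
  λ'≡ = +-cancelˡ-≡ λ' λ' (eigenvalue s t) (begin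
    λ' + λ'              ≡⟨ double λ' ⟩
    2 * λ'               ≡⟨ sym q+1+s≡2λ' ⟩
    λ' + 2 + t + 1 + s   ≡⟨ regroup λ' s t ⟩
    λ' + (3 + s + t)     ∎)

lemma6 : (n λ' : ℕ) → 10 ≤ n → 2 ∣ n → n + 2 ≤ 4 * λ' → 2 * λ' ≤ n ∸ 4 →
    IsPartition n ((λ' + 1) ∷ ((n + 2 ∸ 2 * λ') / 2) ∷ 3 ∷ (replicate ((n ∸ 4) / 2 ∸ λ') 2 ++ replicate ((4 * λ' ∸ n ∸ 2) / 2) 1))
      × Λ ((λ' + 1) ∷ ((n + 2 ∸ 2 * λ') / 2) ∷ 3 ∷ (replicate ((n ∸ 4) / 2 ∸ λ') 2 ++ replicate ((4 * λ' ∸ n ∸ 2) / 2) 1)) ≡ + λ'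
lemma6 _ λ' 10≤n (divides q refl) n+2≤4λ' 2λ'≤n∸4
  with parametrise {q} {λ'} (2*m≤n*2∸4⇒m+2≤n (≤-trans (m≤m+n 4 6) 10≤n) 2λ'≤n∸4) (n*2+2≤4*m⇒n+1≤2*m {λ'} n+2≤4λ')
... | s , t , refl , refl =
  subst (λ xs → IsPartition ((5 + s + t * 2) * 2) xs × Λ xs ≡ + eigenvalue s t)
        (sym (parts≡shape s t))
        (shape-isPartition s t , Λ-shape s t)
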